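{- There exists a Lucas semigroup that is not a local Lucas semigroup.
   Context: $\mathbb{N}=\{0,1,2,\ldots\}$. For $P,Q\in\mathbb{Z}$, the Lucas sequence $U_n=U_n(P,Q)$ is defined by $U_0=0$, $U_1=1$, $U_{n+2}=PU_{n+1}-QU_n$. For $R\in\mathbb{Q}$, $\mathcal{L}(P,Q,R)=\{n\in\mathbb{N} : U_nR\in\mathbb{Z}\}$. A Lucas semigroup is a set of the form $\mathcal{L}(P,Q,R)$ with $P,Q\in\mathbb{Z}$, $R\in\mathbb{Q}$; a local Lucas semigroup is one of the form $\mathcal{L}(P,Q,p^{ -r})$ with $P,Q\in\mathbb{Z}$, $p$ prime, and $r\in\mathbb{Z}$. -}

module Defs where

open import Data.Nat as ℕ using (ℕ; zero; suc; NonZero)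
open import Data.Nat.Properties using (m^n≢0)
open import Data.Nat.Primality using (Prime; prime⇒nonZero)
open import Data.Integer as ℤ using (ℤ; +_; -[1+_])
open import Data.Rational as ℚ using (ℚ; _/_)
open import Data.Product using (Σ; ∃)
open import Relation.Binary.PropositionalEquality using (_≡_)
open import Function.Bundles using (_⇔_)

U : ℤ → ℤ → ℕ → ℤ
U P Q zero = + 0
U P Q (suc zero) = + 1
U P Q (suc (suc n)) = P ℤ.* U P Q (suc n) ℤ.- Q ℤ.* U P Q n

IsInt : ℚ → Set
IsInt x = ∃ λ (z : ℤ) → x ≡ z / 1

L : ℤ → ℤ → ℚ → ℕ → Set
L P Q R n = IsInt ((U P Q n / 1) ℚ.* R)

pow⁻ : (p : ℕ) → Prime p → ℤ → ℚ
pow⁻ p pp (+ k) = + 1 / (p ℕ.^ k)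
  where instance _ = prime⇒nonZero pp
                 _ = m^n≢0 p k
pow⁻ p pp -[1+ k ] = (+ (p ℕ.^ suc k)) / 1

_≐_ : (ℕ → Set) → (ℕ → Set) → Set
A ≐ B = ∀ n → A n ⇔ B n

IsLucasSemigroup : (ℕ → Set) → Set
IsLucasSemigroup S = ∃ λ (P : ℤ) → ∃ λ (Q : ℤ) → ∃ λ (R : ℚ) → S ≐ L P Q R

IsLocalLucasSemigroup : (ℕ → Set) → Set
IsLocalLucasSemigroup S =
  ∃ λ (P : ℤ) → ∃ λ (Q : ℤ) → ∃ λ (p : ℕ) → Σ (Prime p) λ pp → ∃ λ (r : ℤ) →
    S ≐ L P Q (pow⁻ p pp r)

-- Let S = {0} ∪ {4, 6, 8, …}. Modulo 3 the sequence U(6,2) alternates 0, 1, 0, 1, …, and 2-adically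
-- U_{2j+2}(6,2) is divisible by 2^{j+1}; hence 12 ∣ U_n(6,2) exactly for n ∈ S, i.e. S = L(6,2,1/12).
-- S is not local: 1 ∉ S rules out r ≤ 0, so p^r ∣ U_n ⇔ n ∈ S with r ≥ 1. If p divides P and Q then
-- p^j ∣ U_{2j+1}, contradicting odd n ∉ S. If p ∣ Q but not P, then U_4 ≡ P^3 (mod p) forces p ∣ P.
-- If p ∤ Q, the recurrence turns p^r ∣ U_4, U_6 into p^r ∣ P U_3, and either way p^r ∣ P = U_2,
-- contradicting 2 ∉ S.
module Submission where

open import Defs
open import Data.Nat using (ℕ)
open import Data.Product using (Σ; _×_)
open import Relation.Nullary using (¬_)

open import Data.Nat as ℕ using (zero; suc; NonZero; _^_)
import Data.Nat.Properties as ℕ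
import Data.Nat.Divisibility as ℕ
open import Data.Nat.Primality using (Prime; prime⇒nonZero; euclidsLemma)
open import Data.Integer as ℤ using (ℤ; +_; -[1+_]; _*_; _-_; _+_; ∣_∣)
import Data.Integer.Properties as ℤ
open import Data.Integer.Divisibility.Signed
open import Data.Integer.Tactic.RingSolver using (solve-∀)
open import Data.Rational as ℚ using (_/_)
import Data.Rational.Properties as ℚ
open import Data.Rational.Unnormalised using (mkℚᵘ; *≡*; _≃_)
import Data.Rational.Unnormalised.Properties as ℚᵘ
open import Data.Product using (_,_; proj₁; proj₂)
open import Data.Sum using (_⊎_; inj₁; inj₂)
open import Data.Empty using (⊥-elim)
open import Relation.Nullary using (yes; no)
open import Relation.Nullary.Decidable using (from-no)
open import Relation.Binary.PropositionalEquality
open import Function using (_⇔_; mk⇔; Equivalence)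
import Function.Properties.Equivalence as ⇔

∣m-n∣n⇒∣m : ∀ {i m n} → i ∣ m - n → i ∣ n → i ∣ m
∣m-n∣n⇒∣m i∣m-n i∣n = ∣m+n∣n⇒∣m i∣m-n (∣m⇒∣-m i∣n)

∣m-n∣m⇒∣n : ∀ {i m n} → i ∣ m - n → i ∣ m → i ∣ n
∣m-n∣m⇒∣n {n = n} i∣m-n i∣m = subst (_ ∣_) (ℤ.neg-involutive n) (∣m⇒∣-m (∣m+n∣m⇒∣n i∣m-n i∣m))

∣m-n∣n-o⇒∣m-o : ∀ {i m n o} → i ∣ m - n → i ∣ n - o → i ∣ m - o
∣m-n∣n-o⇒∣m-o {m = m} {n} {o} i∣m-n i∣n-o =
  subst (_ ∣_) (telescope m n o) (∣m∣n⇒∣m+n i∣m-n i∣n-o)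
  where
  telescope : ∀ m n o → (m - n) + (n - o) ≡ m - o
  telescope = solve-∀

*-pres-∣ : ∀ {i j m n} → i ∣ m → j ∣ n → i * j ∣ m * n
*-pres-∣ {i} {j} (divides a refl) (divides b refl) = divides (a * b) (interchange a i b j)
  where
  interchange : ∀ a i b j → (a * i) * (b * j) ≡ (a * b) * (i * j)
  interchange = solve-∀

d*d^j∣ : ∀ {d j x y} → + d ∣ x → + (d ^ j) ∣ y → + (d ^ suc j) ∣ x * y
d*d^j∣ {d} {j} d∣x d^j∣y = subst (_∣ _) (sym (ℤ.pos-* d (d ^ j))) (*-pres-∣ d∣x d^j∣y)

module _ {p : ℕ} (p-prime : Prime p) where

  private instance
    p≢0 : NonZero p
    p≢0 = prime⇒nonZero p-prime

  euclidsLemmaℤ : ∀ m n → + p ∣ m * n → (+ p ∣ m) ⊎ (+ p ∣ n)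
  euclidsLemmaℤ m n p∣mn with euclidsLemma ∣ m ∣ ∣ n ∣ p-prime (subst (p ℕ.∣_) (ℤ.abs-* m n) (∣⇒∣ᵤ p∣mn))
  ... | inj₁ p∣m = inj₁ (∣ᵤ⇒∣ p∣m)
  ... | inj₂ p∣n = inj₂ (∣ᵤ⇒∣ p∣n)

  prime^∣m*n⇒∣n : ∀ {m} → ¬ p ℕ.∣ m → ∀ k {n} → p ^ k ℕ.∣ m ℕ.* n → p ^ k ℕ.∣ n
  prime^∣m*n⇒∣n p∤m zero {n} _ = ℕ.1∣ n
  prime^∣m*n⇒∣n {m} p∤m (suc k) {n} p^k+1∣mn
    with euclidsLemma m n p-prime (ℕ.∣-trans (ℕ.m∣m*n (p ^ k)) p^k+1∣mn)
  ... | inj₁ p∣m = ⊥-elim (p∤m p∣m)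
  ... | inj₂ (ℕ.divides c refl) =
    subst (p ^ suc k ℕ.∣_) (ℕ.*-comm p c)
      (ℕ.*-monoʳ-∣ p (prime^∣m*n⇒∣n p∤m k (ℕ.*-cancelˡ-∣ p (subst (p ^ suc k ℕ.∣_) m[cp]≡p[mc] p^k+1∣mn))))
    where
    m[cp]≡p[mc] : m ℕ.* (c ℕ.* p) ≡ p ℕ.* (m ℕ.* c)
    m[cp]≡p[mc] = trans (sym (ℕ.*-assoc m c p)) (ℕ.*-comm (m ℕ.* c) p)

  prime^∣m*n⇒∣nℤ : ∀ {m n} → ¬ (+ p ∣ m) → ∀ k → + (p ^ k) ∣ m * n → + (p ^ k) ∣ n
  prime^∣m*n⇒∣nℤ {m} {n} p∤m k p^k∣mn = ∣ᵤ⇒∣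
    (prime^∣m*n⇒∣n (λ p∣m → p∤m (∣ᵤ⇒∣ p∣m)) k (subst (p ^ k ℕ.∣_) (ℤ.abs-* m n) (∣⇒∣ᵤ p^k∣mn)))

isInt[z*1/d]⇔d∣z : ∀ z d .{{_ : NonZero d}} → IsInt ((z / 1) ℚ.* (+ 1 / d)) ⇔ (+ d ∣ z)
isInt[z*1/d]⇔d∣z z (suc k) = mk⇔ to from
  where
  z*1/d≃ : ℚ.toℚᵘ ((z / 1) ℚ.* (+ 1 / suc k)) ≃ mkℚᵘ (z * + 1) (k ℕ.+ 0)
  z*1/d≃ = ℚᵘ.≃-trans (ℚ.toℚᵘ-homo-* (z / 1) (+ 1 / suc k))
             (ℚᵘ.*-cong (ℚ.toℚᵘ-fromℚᵘ (mkℚᵘ z 0)) (ℚ.toℚᵘ-fromℚᵘ (mkℚᵘ (+ 1) k)))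
  cross : ∀ w → (z * + 1) * + 1 ≡ w * + suc (k ℕ.+ 0) → z ≡ w * + suc k
  cross w e = trans (sym (trans (ℤ.*-identityʳ _) (ℤ.*-identityʳ z)))
                    (trans e (cong (λ x → w * + suc x) (ℕ.+-identityʳ k)))
  cross⁻¹ : ∀ w → z ≡ w * + suc k → (z * + 1) * + 1 ≡ w * + suc (k ℕ.+ 0)
  cross⁻¹ w e = trans (trans (ℤ.*-identityʳ _) (ℤ.*-identityʳ z))
                      (trans e (cong (λ x → w * + suc x) (sym (ℕ.+-identityʳ k))))
  to : IsInt ((z / 1) ℚ.* (+ 1 / suc k)) → + suc k ∣ z
  to (w , eq) with ℚᵘ.≃-trans (ℚᵘ.≃-sym z*1/d≃) (ℚᵘ.≃-trans (ℚ.toℚᵘ-cong eq) (ℚ.toℚᵘ-fromℚᵘ (mkℚᵘ w 0)))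
  ... | *≡* e = divides w (cross w e)
  from : + suc k ∣ z → IsInt ((z / 1) ℚ.* (+ 1 / suc k))
  from (divides w e) = w , ℚ.toℚᵘ-injective
    (ℚᵘ.≃-trans z*1/d≃ (ℚᵘ.≃-trans (*≡* (cross⁻¹ w e)) (ℚᵘ.≃-sym (ℚ.toℚᵘ-fromℚᵘ (mkℚᵘ w 0)))))

odd : ℕ → ℕ
odd zero = 1
odd (suc j) = suc (suc (odd j))

ev : ℕ → ℕ
ev j = suc (odd j)

parity : ∀ n → n ≡ 0 ⊎ Σ ℕ (λ j → n ≡ odd j) ⊎ Σ ℕ (λ j → n ≡ ev j)
parity zero = inj₁ refl
parity (suc n) with parity n
... | inj₁ refl = inj₂ (inj₁ (0 , refl))
... | inj₂ (inj₁ (j , refl)) = inj₂ (inj₂ (j , refl))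
... | inj₂ (inj₂ (j , refl)) = inj₂ (inj₁ (suc j , refl))

odd≢ev : ∀ j k → odd j ≢ ev k
odd≢ev zero zero ()
odd≢ev zero (suc k) ()
odd≢ev (suc zero) zero ()
odd≢ev (suc (suc j)) zero ()
odd≢ev (suc j) (suc k) e = odd≢ev j k (ℕ.suc-injective (ℕ.suc-injective e))

U₂≡P : ∀ P Q → U P Q 2 ≡ P
U₂≡P = unit
  where
  unit : ∀ P Q → P * + 1 - Q * + 0 ≡ P
  unit = solve-∀

module _ {P Q : ℤ} where

  d∣P∧d∣Q⇒d^j∣U : ∀ {d} → + d ∣ P → + d ∣ Q → ∀ j →
                   (+ (d ^ j) ∣ U P Q (odd j)) × (+ (d ^ suc j) ∣ U P Q (ev j))
  d∣P∧d∣Q⇒d^j∣U d∣P d∣Q zero =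
    ∣-refl , ∣m∣n⇒∣m-n (d*d^j∣ {j = 0} d∣P ∣-refl) (d*d^j∣ {j = 0} d∣Q (divides (+ 0) refl))
  d∣P∧d∣Q⇒d^j∣U {d} d∣P d∣Q (suc j) =
    d^j∣U-odd , ∣m∣n⇒∣m-n (d*d^j∣ {j = suc j} d∣P d^j∣U-odd) (d*d^j∣ {j = suc j} d∣Q d^j∣U-ev)
    where
    d^j∣U-ev = proj₂ (d∣P∧d∣Q⇒d^j∣U d∣P d∣Q j)
    d^j∣U-odd : + (d ^ suc j) ∣ U P Q (odd (suc j))
    d^j∣U-odd = ∣m∣n⇒∣m-n (∣n⇒∣m*n P d^j∣U-ev) (d*d^j∣ {j = j} d∣Q (proj₁ (d∣P∧d∣Q⇒d^j∣U d∣P d∣Q j)))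

S : ℕ → Set
S n = n ≡ 0 ⊎ Σ ℕ (λ j → n ≡ ev (suc j))

1∉S : ¬ S 1
1∉S (inj₁ ())
1∉S (inj₂ (_ , ()))

2∉S : ¬ S 2
2∉S (inj₁ ())
2∉S (inj₂ (_ , ()))

odd∉S : ∀ j → ¬ S (odd j)
odd∉S zero (inj₁ ())
odd∉S (suc j) (inj₁ ())
odd∉S j (inj₂ (k , e)) = odd≢ev j (suc k) e

V : ℕ → ℤ
V = U (+ 6) (+ 2)

3∣V[n+2]-V[n] : ∀ n → + 3 ∣ V (suc (suc n)) - V n
3∣V[n+2]-V[n] n = divides (+ 2 * V (suc n) - V n) (factor (V (suc n)) (V n))
  where
  factor : ∀ a b → (+ 6 * a - + 2 * b) - b ≡ (+ 2 * a - b) * + 3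
  factor = solve-∀

V-mod-3 : ∀ j → (+ 3 ∣ V (odd j) - + 1) × (+ 3 ∣ V (ev j))
V-mod-3 zero = divides (+ 0) refl , divides (+ 2) refl
V-mod-3 (suc j) =
    ∣m-n∣n-o⇒∣m-o {m = V (odd (suc j))} {n = V (odd j)} (3∣V[n+2]-V[n] (odd j)) (proj₁ (V-mod-3 j))
  , ∣m-n∣n⇒∣m (3∣V[n+2]-V[n] (ev j)) (proj₂ (V-mod-3 j))

4∣V-ev : ∀ j → + 4 ∣ V (ev (suc j))
4∣V-ev j = ∣-trans (∣ᵤ⇒∣ 4∣2^[j+2]) (proj₂ (d∣P∧d∣Q⇒d^j∣U (divides (+ 3) refl) ∣-refl (suc j)))
  where
  4∣2^[j+2] : 4 ℕ.∣ 2 ^ suc (suc j)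
  4∣2^[j+2] = subst (4 ℕ.∣_) (ℕ.*-assoc 2 2 (2 ^ j)) (ℕ.m∣m*n (2 ^ j))

3∣∧4∣⇒12∣ : ∀ {u} → + 3 ∣ u → + 4 ∣ u → + 12 ∣ u
3∣∧4∣⇒12∣ {u} (divides a u≡3a) (divides b u≡4b) = divides (a - b)
  (trans (split u) (trans (cong₂ (λ s t → s * + 4 - t * + 3) u≡3a u≡4b) (regroup a b)))
  where
  split : ∀ u → u ≡ u * + 4 - u * + 3
  split = solve-∀
  regroup : ∀ a b → (a * + 3) * + 4 - (b * + 4) * + 3 ≡ (a - b) * + 12
  regroup = solve-∀

S⇔12∣V : ∀ n → S n ⇔ + 12 ∣ V n
S⇔12∣V n = mk⇔ to (from (parity n))
  where
  to : S n → + 12 ∣ V n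
  to (inj₁ refl) = divides (+ 0) refl
  to (inj₂ (j , refl)) = 3∣∧4∣⇒12∣ (proj₂ (V-mod-3 (suc j))) (4∣V-ev j)
  from : n ≡ 0 ⊎ Σ ℕ (λ j → n ≡ odd j) ⊎ Σ ℕ (λ j → n ≡ ev j) → + 12 ∣ V n → S n
  from (inj₁ refl) _ = inj₁ refl
  from (inj₂ (inj₁ (j , refl))) 12∣V = ⊥-elim (from-no (+ 3 ∣? + 1)
    (∣m-n∣m⇒∣n (proj₁ (V-mod-3 j)) (∣-trans (divides (+ 4) refl) 12∣V)))
  from (inj₂ (inj₂ (zero , refl))) 12∣6 = ⊥-elim (from-no (+ 12 ∣? + 6) 12∣6)
  from (inj₂ (inj₂ (suc j , refl))) _ = inj₂ (j , refl)

S-isLucas : IsLucasSemigroup S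
S-isLucas = + 6 , + 2 , + 1 / 12 , λ n → ⇔.trans (S⇔12∣V n) (⇔.sym (isInt[z*1/d]⇔d∣z (V n) 12))

module _ {p : ℕ} (p-prime : Prime p) {P Q : ℤ} where

  p∣Q∧p∣U₄⇒p∣P : + p ∣ Q → + p ∣ U P Q 4 → + p ∣ P
  p∣Q∧p∣U₄⇒p∣P p∣Q p∣U₄ with euclidsLemmaℤ p-prime P (U P Q 3) (∣m-n∣n⇒∣m p∣U₄ (∣m⇒∣m*n (U P Q 2) p∣Q))
  ... | inj₁ p∣P = p∣P
  ... | inj₂ p∣U₃ with euclidsLemmaℤ p-prime P (U P Q 2) (∣m-n∣n⇒∣m p∣U₃ (∣m⇒∣m*n (+ 1) p∣Q))
  ...   | inj₁ p∣P = p∣P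
  ...   | inj₂ p∣U₂ = subst (+ p ∣_) (U₂≡P P Q) p∣U₂

  p∤Q∧p^k∣U₄∧p^k∣U₆⇒p^k∣P*U₃ : ¬ (+ p ∣ Q) → ∀ k →
    + (p ^ k) ∣ U P Q 4 → + (p ^ k) ∣ U P Q 6 → + (p ^ k) ∣ P * U P Q 3
  p∤Q∧p^k∣U₄∧p^k∣U₆⇒p^k∣P*U₃ p∤Q k p^k∣U₄ p^k∣U₆ = prime^∣m*n⇒∣nℤ p-prime p∤Q k
    (∣m-n∣m⇒∣n (subst (_ ∣_) (expand P Q (U P Q 4) (U P Q 3)) p^k∣P*U₅) (∣n⇒∣m*n P (∣n⇒∣m*n P p^k∣U₄)))
    where
    p^k∣P*U₅ : + (p ^ k) ∣ P * U P Q 5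
    p^k∣P*U₅ = ∣m-n∣n⇒∣m p^k∣U₆ (∣n⇒∣m*n Q p^k∣U₄)
    expand : ∀ P Q u₄ u₃ → P * (P * u₄ - Q * u₃) ≡ P * (P * u₄) - Q * (P * u₃)
    expand = solve-∀

  p∤Q∧p^k∣U₄∧p^k∣U₆⇒p^k∣U₂ : ¬ (+ p ∣ Q) → ∀ k →
    + (p ^ k) ∣ U P Q 4 → + (p ^ k) ∣ U P Q 6 → + (p ^ k) ∣ U P Q 2
  p∤Q∧p^k∣U₄∧p^k∣U₆⇒p^k∣U₂ p∤Q k p^k∣U₄ p^k∣U₆ with + p ∣? U P Q 3
  ... | no p∤U₃ = subst (_ ∣_) (sym (U₂≡P P Q))
                    (prime^∣m*n⇒∣nℤ p-prime p∤U₃ k (subst (_ ∣_) (ℤ.*-comm P (U P Q 3)) p^k∣P*U₃))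
    where
    p^k∣P*U₃ : + (p ^ k) ∣ P * U P Q 3
    p^k∣P*U₃ = p∤Q∧p^k∣U₄∧p^k∣U₆⇒p^k∣P*U₃ p∤Q k p^k∣U₄ p^k∣U₆
  ... | yes p∣U₃ = prime^∣m*n⇒∣nℤ p-prime p∤Q k (∣m-n∣m⇒∣n p^k∣U₄ (∣n⇒∣m*n P p^k∣U₃))
    where
    p∤P : ¬ (+ p ∣ P)
    p∤P p∣P = p∤Q (subst (+ p ∣_) (ℤ.*-identityʳ Q) (∣m-n∣m⇒∣n p∣U₃ (∣m⇒∣m*n (U P Q 2) p∣P)))
    p^k∣U₃ : + (p ^ k) ∣ U P Q 3
    p^k∣U₃ = prime^∣m*n⇒∣nℤ p-prime p∤P k (p∤Q∧p^k∣U₄∧p^k∣U₆⇒p^k∣P*U₃ p∤Q k p^k∣U₄ p^k∣U₆)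

  ¬[S⇔p^[r+1]∣U] : ∀ r → ¬ (∀ n → S n ⇔ + (p ^ suc r) ∣ U P Q n)
  ¬[S⇔p^[r+1]∣U] r S⇔ with + p ∣? Q
  ... | no p∤Q = 2∉S (Equivalence.from (S⇔ 2)
                   (p∤Q∧p^k∣U₄∧p^k∣U₆⇒p^k∣U₂ p∤Q (suc r) (Equivalence.to (S⇔ 4) (inj₂ (0 , refl)))
                                                        (Equivalence.to (S⇔ 6) (inj₂ (1 , refl)))))
  ... | yes p∣Q = odd∉S (suc r) (Equivalence.from (S⇔ (odd (suc r))) (proj₁ (d∣P∧d∣Q⇒d^j∣U p∣P p∣Q (suc r))))
    where
    p∣P : + p ∣ P
    p∣P = p∣Q∧p∣U₄⇒p∣P p∣Q (∣-trans (∣ᵤ⇒∣ (ℕ.m∣m*n (p ^ r))) (Equivalence.to (S⇔ 4) (inj₂ (0 , refl))))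

S-nonLocal : ¬ IsLocalLucasSemigroup S
S-nonLocal (P , Q , p , p-prime , -[1+ k ] , S⇔L) =
  1∉S (Equivalence.from (S⇔L 1) (+ (p ^ suc k) , ℚ.*-identityˡ _))
S-nonLocal (P , Q , p , p-prime , + zero , S⇔L) =
  1∉S (Equivalence.from (S⇔L 1) (+ 1 , refl))
S-nonLocal (P , Q , p , p-prime , + suc r , S⇔L) =
  ¬[S⇔p^[r+1]∣U] p-prime r λ n → ⇔.trans (S⇔L n) (isInt[z*1/d]⇔d∣z (U P Q n) (p ^ suc r))
  where
  instance
    _ = ℕ.m^n≢0 p (suc r) ⦃ prime⇒nonZero p-prime ⦄

theorem7p1 : Σ (ℕ → Set) λ S → IsLucasSemigroup S × ¬ IsLocalLucasSemigroup S
theorem7p1 = S , S-isLucas , S-nonLocal
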